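{- Let $q$ be a positive integer, $x_1, \ldots, x_q \in \mathbb{C}$, and let $r$ be an integer with $1 \leqslant r < q$. Then $$\sum_{s=1}^q (-1)^{s-1} \sum_{1\leqslant k_1<\cdots<k_s\leqslant q}\ \sum_{\substack{j_{k_1},\ldots,j_{k_s}\geqslant 0\\ j_{k_1}+\cdots+j_{k_s}=r}} \binom{2r}{2j_{k_1},\ldots,2j_{k_s}} x_{k_1}^{j_{k_1}}\cdots x_{k_s}^{j_{k_s}} = 0,$$ where $\binom{2r}{2j_{k_1},\ldots,2j_{k_s}} = \frac{(2r)!}{(2j_{k_1})!\cdots(2j_{k_s})!}$. -}

module Defs where

open import Level using (Level)
open import Data.Nat as ℕ using (ℕ; zero; suc; _∸_; _!; NonZero)
open import Data.Nat.Properties using (m*n≢0; _!≢0)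
open import Data.Fin using (Fin)
import Data.Fin as F
open import Data.List using (List; []; _∷_; _++_; foldr; concatMap; upTo)
import Data.List as L
open import Data.Vec using (Vec; []; _∷_)
import Data.Vec as V
open import Algebra.Bundles using (CommutativeRing)

-- All strictly increasing tuples (k₁ < ⋯ < kₛ) of elements of Fin q,
-- i.e. all s-element subsets of {0,…,q-1} listed in increasing order.
incVecs : (q s : ℕ) → List (Vec (Fin q) s)
incVecs q       zero    = [] ∷ []
incVecs zero    (suc s) = []
incVecs (suc q) (suc s) =
  L.map (V.map F.suc) (incVecs q (suc s))
  ++ L.map (λ v → F.zero ∷ V.map F.suc v) (incVecs q s)

comps : (s r : ℕ) → List (Vec ℕ s)
comps zero    zero    = [] ∷ []
comps zero    (suc r) = []
comps (suc s) r = concatMap (λ j → L.map (j ∷_) (comps s (r ∸ j))) (upTo (suc r))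

prodFact : ∀ {s} → Vec ℕ s → ℕ
prodFact []       = 1
prodFact (a ∷ as) = a ! ℕ.* prodFact as

prodFact≢0 : ∀ {s} (as : Vec ℕ s) → NonZero (prodFact as)
prodFact≢0 []       = _
prodFact≢0 (a ∷ as) = m*n≢0 (a !) (prodFact as) {{a !≢0}} {{prodFact≢0 as}}

multinomial : ∀ {s} → ℕ → Vec ℕ s → ℕ
multinomial n as = (n !) ℕ./ prodFact as
  where instance _ = prodFact≢0 as

module InRing {c ℓ} (R : CommutativeRing c ℓ) where
  open CommutativeRing R

  fromℕ : ℕ → Carrier
  fromℕ zero    = 0#
  fromℕ (suc n) = 1# + fromℕ n

  infixr 8 _^_
  _^_ : Carrier → ℕ → Carrier
  x ^ zero  = 1#
  x ^ suc n = x * (x ^ n)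

  sign : ℕ → Carrier
  sign zero    = 1#
  sign (suc n) = - sign n

  sumL : List Carrier → Carrier
  sumL = foldr _+_ 0#

  prodV : ∀ {s} → Vec Carrier s → Carrier
  prodV = V.foldr _ _*_ 1#

  inner : ∀ {q s} → (Fin q → Carrier) → ℕ → Vec (Fin q) s → Carrier
  inner {s = s} x r k = sumL (L.map
    (λ j → fromℕ (multinomial (2 ℕ.* r) (V.map (2 ℕ.*_) j))
           * prodV (V.zipWith (λ kᵢ jᵢ → x kᵢ ^ jᵢ) k j))
    (comps s r))

  LHS : (q : ℕ) → (Fin q → Carrier) → ℕ → Carrier
  LHS q x r = sumL (L.map
    (λ t → sign t * sumL (L.map (inner x r) (incVecs q (suc t))))
    (upTo q))

{-# OPTIONS --safe #-}
module Submission where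

-- Encode a sequence (uₙ) by the series Σₙ uₙ t²ⁿ/(2n)!; products of such series become the
-- binomial convolution _⋆_ with weights (2m choose 2j). The inner sum over j for a subset K is
-- then the coefficient sequence of ∏_{k∈K} cosh(√xₖ t), i.e. of the ⋆-product of the power
-- sequences n ↦ xₖⁿ, and the signed sum over all subsets K, the empty one included, is that of
-- ∏ₖ (1 − cosh(√xₖ t)). Every factor has zero constant term, so this product has no coefficient
-- below t^{2q}; for 1 ≤ r < q the theorem's sum is minus its coefficient of t^{2r}.
-- Concretely, the coefficient sequence Q_x (alternatingSum) satisfies
-- Q_x = Q_{x'} − (x₁ⁿ)ₙ ⋆ Q_{x'} with x' = (x₂, …, x_q), and induction on q shows Q_x m = 0 for m < q.

open import Defs
open import Data.Nat as ℕ using (ℕ; zero; suc; _∸_; _!; _≤_; _<_; s≤s)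
import Data.Nat.Properties as ℕₚ
open import Data.Nat.DivMod using (_/_; m*n/n≡m; m/n*n≡m; /-congˡ; n/n≡1)
open import Data.Nat.Divisibility using (_∣_; *-monoʳ-∣; ∣-trans; ∣-refl)
open import Data.Nat.Combinatorics using (k![n∸k]!∣n!)
open import Data.Fin as Fin using (Fin; toℕ)
open import Data.Fin.Properties using (toℕ-inject₁; toℕ-fromℕ; toℕ<n)
open import Data.List using (List; []; _∷_; _++_; concatMap; applyUpTo; upTo)
import Data.List as L
open import Data.List.Properties using (map-∘; map-cong)
open import Data.List.Relation.Unary.All as All using (All; []; _∷_)
open import Data.List.Relation.Unary.All.Properties using (concat⁺; map⁺; applyUpTo⁺₁)
open import Data.Vec using (Vec; []; _∷_)
import Data.Vec as V
open import Data.Vec.Properties using (zipWith-map₁)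
open import Data.Vec.Functional using (Vector; head; tail)
open import Function using (_∘_)
open import Relation.Binary.PropositionalEquality as ≡ using (_≡_)
open import Algebra.Bundles using (CommutativeRing)

module _ where
  open import Data.Nat using (_+_; _*_)
  open ℕₚ using (*-zeroʳ; *-distribˡ-+; *-distribˡ-∸; *-identityˡ; *-assoc; *-monoʳ-≤; m*n≢0; _!≢0;
                 m+n∸m≡n; m≤m+n; m+[n∸m]≡n; ≤-pred; m<n⇒m<1+n)
  open import Algebra.Properties.CommutativeSemigroup ℕₚ.*-commutativeSemigroup
    using (x∙yz≈y∙xz)
  open ≡ using (refl; sym; trans; cong; subst; module ≡-Reasoning)

  sum-map-*ˡ : ∀ {s} c (as : Vec ℕ s) → V.sum (V.map (c *_) as) ≡ c * V.sum as
  sum-map-*ˡ c []       = sym (*-zeroʳ c)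
  sum-map-*ˡ c (a ∷ as) = trans (cong (c * a +_) (sum-map-*ˡ c as)) (sym (*-distribˡ-+ c a (V.sum as)))

  prodFact∣sum! : ∀ {s} (as : Vec ℕ s) → prodFact as ∣ V.sum as !
  prodFact∣sum! []       = ∣-refl
  prodFact∣sum! (a ∷ as) = ∣-trans (*-monoʳ-∣ (a !) (prodFact∣sum! as))
    (subst (λ n → a ! * n ! ∣ (a + V.sum as) !) (m+n∸m≡n a (V.sum as))
           (k![n∸k]!∣n! (m≤m+n a (V.sum as))))

  multinomial*prodFact≡! : ∀ {s n} (as : Vec ℕ s) → V.sum as ≡ n →
                           multinomial n as * prodFact as ≡ n !
  multinomial*prodFact≡! as refl = m/n*n≡m (prodFact∣sum! as)
    where instance _ = prodFact≢0 as

  -- Equal to n C k of Data.Nat.Combinatorics, which is not defined by this closed form.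
  binomial : ℕ → ℕ → ℕ
  binomial n k = n ! / (k ! * (n ∸ k) !)
    where instance _ = m*n≢0 (k !) ((n ∸ k) !) {{k !≢0}} {{(n ∸ k) !≢0}}

  binomial*k!*[n∸k]!≡n! : ∀ {n k} → k ≤ n → binomial n k * (k ! * (n ∸ k) !) ≡ n !
  binomial*k!*[n∸k]!≡n! {n} {k} k≤n = m/n*n≡m (k![n∸k]!∣n! k≤n)
    where instance _ = m*n≢0 (k !) ((n ∸ k) !) {{k !≢0}} {{(n ∸ k) !≢0}}

  binomial[n,0]≡1 : ∀ n → binomial n 0 ≡ 1
  binomial[n,0]≡1 n = trans (/-congˡ (sym (*-identityˡ (n !)))) (n/n≡1 (1 * n !))
    where instance _ = m*n≢0 1 (n !) {{_}} {{n !≢0}}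

  multinomial-∷ : ∀ {s} n a (as : Vec ℕ s) → a ≤ n → V.sum as ≡ n ∸ a →
                  multinomial n (a ∷ as) ≡ binomial n a * multinomial (n ∸ a) as
  multinomial-∷ n a as a≤n Σas≡n∸a = trans (/-congˡ n!≡) (m*n/n≡m (B * M) (a ! * prodFact as))
    where
    instance
      _ = prodFact≢0 as
      _ = prodFact≢0 (a ∷ as)
    B = binomial n a
    M = multinomial (n ∸ a) as
    open ≡-Reasoning
    n!≡ : n ! ≡ (B * M) * (a ! * prodFact as)
    n!≡ = begin
      n !
        ≡⟨ binomial*k!*[n∸k]!≡n! a≤n ⟨
      B * (a ! * (n ∸ a) !)
        ≡⟨ cong (λ z → B * (a ! * z)) (multinomial*prodFact≡! as Σas≡n∸a) ⟨
      B * (a ! * (M * prodFact as))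
        ≡⟨ cong (B *_) (x∙yz≈y∙xz (a !) M (prodFact as)) ⟩
      B * (M * (a ! * prodFact as))
        ≡⟨ *-assoc B M _ ⟨
      (B * M) * (a ! * prodFact as) ∎

  multinomial-*2-∷ : ∀ {s} m j₀ (j : Vec ℕ s) → j₀ ≤ m → V.sum j ≡ m ∸ j₀ →
    multinomial (2 * m) (V.map (2 *_) (j₀ ∷ j))
      ≡ binomial (2 * m) (2 * j₀) * multinomial (2 * (m ∸ j₀)) (V.map (2 *_) j)
  multinomial-*2-∷ m j₀ j j₀≤m Σj≡m∸j₀ = begin
    multinomial (2 * m) (2 * j₀ ∷ V.map (2 *_) j)
      ≡⟨ multinomial-∷ (2 * m) (2 * j₀) (V.map (2 *_) j) (*-monoʳ-≤ 2 j₀≤m) Σ2j≡2m∸2j₀ ⟩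
    binomial (2 * m) (2 * j₀) * multinomial (2 * m ∸ 2 * j₀) (V.map (2 *_) j)
      ≡⟨ cong (λ n → binomial (2 * m) (2 * j₀) * multinomial n (V.map (2 *_) j)) (*-distribˡ-∸ 2 m j₀) ⟨
    binomial (2 * m) (2 * j₀) * multinomial (2 * (m ∸ j₀)) (V.map (2 *_) j) ∎
    where
    open ≡-Reasoning
    Σ2j≡2m∸2j₀ : V.sum (V.map (2 *_) j) ≡ 2 * m ∸ 2 * j₀
    Σ2j≡2m∸2j₀ = trans (sum-map-*ˡ 2 j) (trans (cong (2 *_) Σj≡m∸j₀) (*-distribˡ-∸ 2 m j₀))

  comps-sum≡ : ∀ s r → All (λ j → V.sum j ≡ r) (comps s r)
  comps-sum≡ zero    zero    = refl ∷ []
  comps-sum≡ zero    (suc r) = []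
  comps-sum≡ (suc s) r = concat⁺ (map⁺ (applyUpTo⁺₁ (λ i → i) (suc r) λ {i} i≤r →
    map⁺ (All.map (λ Σj≡r∸i → trans (cong (i +_) Σj≡r∸i) (m+[n∸m]≡n (≤-pred i≤r)))
              (comps-sum≡ s (r ∸ i)))))

  incVecs-[] : ∀ {q s} → q < s → incVecs q s ≡ []
  incVecs-[] {zero}  {suc s} _         = refl
  incVecs-[] {suc q} {suc s} (s≤s q<s)
    rewrite incVecs-[] (m<n⇒m<1+n q<s) | incVecs-[] q<s = refl

module _ {c ℓ} (R : CommutativeRing c ℓ) where
  open CommutativeRing R
  open InRing R
  open import Algebra.Properties.Ring ring using (-‿distribˡ-*; -‿+-comm; -0#≈0#)
  open import Algebra.Properties.Semiring.Sum semiring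
    using (sum; sum-syntax; ∑-comm; ∑-distrib-+; *-distribˡ-sum; sum-cong-≋; sum-cong-≗;
           sum-init-last; sum-replicate-zero)
  open import Algebra.Properties.Semiring.Mult semiring using (_×_; ×1-homo-*)
  open import Algebra.Properties.CommutativeSemigroup *-commutativeSemigroup
    using (interchange; x∙yz≈y∙xz)
  open import Relation.Binary.Reasoning.Setoid setoid

  fromℕ≡×1# : ∀ n → fromℕ n ≡ n × 1#
  fromℕ≡×1# zero    = ≡.refl
  fromℕ≡×1# (suc n) = ≡.cong (1# +_) (fromℕ≡×1# n)

  fromℕ-homo-* : ∀ m n → fromℕ (m ℕ.* n) ≈ fromℕ m * fromℕ n
  fromℕ-homo-* m n rewrite fromℕ≡×1# (m ℕ.* n) | fromℕ≡×1# m | fromℕ≡×1# n = ×1-homo-* m n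

  sumL-map-++ : ∀ {a} {A : Set a} (f : A → Carrier) xs ys →
                sumL (L.map f (xs ++ ys)) ≈ sumL (L.map f xs) + sumL (L.map f ys)
  sumL-map-++ f []       ys = sym (+-identityˡ _)
  sumL-map-++ f (x ∷ xs) ys = trans (+-congˡ (sumL-map-++ f xs ys)) (sym (+-assoc _ _ _))

  sumL-map-concatMap : ∀ {a b} {A : Set a} {B : Set b} (f : B → Carrier) (g : A → List B) xs →
    sumL (L.map f (concatMap g xs)) ≈ sumL (L.map (λ z → sumL (L.map f (g z))) xs)
  sumL-map-concatMap f g []       = refl
  sumL-map-concatMap f g (z ∷ xs) =
    trans (sumL-map-++ f (g z) (concatMap g xs)) (+-congˡ (sumL-map-concatMap f g xs))

  sumL-map-cong : ∀ {a} {A : Set a} {f g : A → Carrier} {xs} →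
                  All (λ z → f z ≈ g z) xs → sumL (L.map f xs) ≈ sumL (L.map g xs)
  sumL-map-cong []           = refl
  sumL-map-cong (fz≈gz ∷ ps) = +-cong fz≈gz (sumL-map-cong ps)

  *-distribˡ-sumL : ∀ {a} {A : Set a} k (f : A → Carrier) xs →
                    k * sumL (L.map f xs) ≈ sumL (L.map (λ z → k * f z) xs)
  *-distribˡ-sumL k f []       = zeroʳ k
  *-distribˡ-sumL k f (z ∷ xs) = trans (distribˡ _ _ _) (+-congˡ (*-distribˡ-sumL k f xs))

  sumL-∑-comm : ∀ {a} {A : Set a} n (h : Fin n → A → Carrier) xs →
    sumL (L.map (λ z → ∑[ i < n ] h i z) xs) ≈ ∑[ i < n ] sumL (L.map (h i) xs)
  sumL-∑-comm n h []       = sym (sum-replicate-zero n)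
  sumL-∑-comm n h (z ∷ xs) = trans (+-congˡ (sumL-∑-comm n h xs)) (sym (∑-distrib-+ {n} _ _))

  sumL-map-applyUpTo : ∀ {a} {A : Set a} (f : A → Carrier) (g : ℕ → A) n →
    sumL (L.map f (applyUpTo g n)) ≡ ∑[ i < n ] f (g (toℕ i))
  sumL-map-applyUpTo f g zero    = ≡.refl
  sumL-map-applyUpTo f g (suc n) = ≡.cong (f (g 0) +_) (sumL-map-applyUpTo f (λ i → g (suc i)) n)

  ∑-last : ∀ n (f : ℕ → Carrier) → ∑[ i < suc n ] f (toℕ i) ≈ ∑[ i < n ] f (toℕ i) + f n
  ∑-last n f = trans (sum-init-last {n} (λ i → f (toℕ i)))
    (reflexive (≡.cong₂ _+_ (sum-cong-≗ {n} (λ i → ≡.cong f (toℕ-inject₁ i)))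
                            (≡.cong f (toℕ-fromℕ n))))

  -‿distrib-sum : ∀ {n} (f : Vector Carrier n) → - sum f ≈ ∑[ i < n ] (- f i)
  -‿distrib-sum {zero}  f = -0#≈0#
  -‿distrib-sum {suc n} f = trans (sym (-‿+-comm _ _)) (+-congˡ (-‿distrib-sum (tail f)))

  ∑-sign-suc : ∀ n (f : ℕ → Carrier) →
    ∑[ i < n ] (sign (suc (toℕ i)) * f (toℕ i)) ≈ - ∑[ i < n ] (sign (toℕ i) * f (toℕ i))
  ∑-sign-suc n f = sym (trans (-‿distrib-sum {n} _) (sum-cong-≋ {n} (λ i → -‿distribˡ-* _ _)))

  binomial₂ : ℕ → ℕ → Carrier
  binomial₂ m j = fromℕ (binomial (2 ℕ.* m) (2 ℕ.* j))

  _⋆_ : (ℕ → Carrier) → (ℕ → Carrier) → ℕ → Carrier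
  (a ⋆ b) m = ∑[ j < suc m ] (binomial₂ m (toℕ j) * a (toℕ j) * b (m ∸ toℕ j))

  ⋆-lowest : ∀ a b m → (∀ n → n < m → b n ≈ 0#) → (a ⋆ b) m ≈ a 0 * b m
  ⋆-lowest a b m b<m≈0 = trans (+-cong (*-congʳ (trans (*-congʳ C₀≈1) (*-identityˡ (a 0)))) higher≈0)
                               (+-identityʳ _)
    where
    C₀≈1 : binomial₂ m 0 ≈ 1#
    C₀≈1 = trans (reflexive (≡.cong fromℕ (binomial[n,0]≡1 (2 ℕ.* m)))) (+-identityʳ 1#)
    higher≈0 : ∑[ i < m ] (binomial₂ m (suc (toℕ i)) * a (suc (toℕ i)) * b (m ∸ suc (toℕ i))) ≈ 0#
    higher≈0 = trans (sum-cong-≋ {m} (λ i →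
                       trans (*-congˡ (b<m≈0 _ (ℕₚ.∸-monoʳ-< ℕ.z<s (toℕ<n i)))) (zeroʳ _)))
                     (sum-replicate-zero m)

  ∑-⋆ : ∀ n (c : Fin n → Carrier) a (b : Fin n → ℕ → Carrier) m →
        ∑[ s < n ] (c s * (a ⋆ b s) m) ≈ (a ⋆ (λ k → ∑[ s < n ] (c s * b s k))) m
  ∑-⋆ n c a b m = begin
    ∑[ s < n ] (c s * ∑[ j < suc m ] (W j * t s j))
      ≈⟨ sum-cong-≋ {n} (λ s → *-distribˡ-sum {suc m} (c s) (λ j → W j * t s j)) ⟩
    ∑[ s < n ] ∑[ j < suc m ] (c s * (W j * t s j))
      ≈⟨ ∑-comm {n} {suc m} (λ s j → c s * (W j * t s j)) ⟩
    ∑[ j < suc m ] ∑[ s < n ] (c s * (W j * t s j))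
      ≈⟨ sum-cong-≋ {suc m} (λ j → sum-cong-≋ {n} (λ s → x∙yz≈y∙xz (c s) (W j) (t s j))) ⟩
    ∑[ j < suc m ] ∑[ s < n ] (W j * (c s * t s j))
      ≈⟨ sum-cong-≋ {suc m} (λ j → sym (*-distribˡ-sum {n} (W j) (λ s → c s * t s j))) ⟩
    (a ⋆ (λ k → ∑[ s < n ] (c s * b s k))) m ∎
    where
    W : Fin (suc m) → Carrier
    W j = binomial₂ m (toℕ j) * a (toℕ j)
    t : Fin n → Fin (suc m) → Carrier
    t s j = b s (m ∸ toℕ j)

  sumL-⋆ : ∀ {a} {A : Set a} (u : ℕ → Carrier) (b : A → ℕ → Carrier) xs m →
           sumL (L.map (λ z → (u ⋆ b z) m) xs) ≈ (u ⋆ (λ k → sumL (L.map (λ z → b z k) xs))) m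
  sumL-⋆ u b xs m = trans (sumL-∑-comm (suc m) (λ j z → W j * b z (m ∸ toℕ j)) xs)
    (sum-cong-≋ {suc m} (λ j → sym (*-distribˡ-sumL (W j) (λ z → b z (m ∸ toℕ j)) xs)))
    where
    W : Fin (suc m) → Carrier
    W j = binomial₂ m (toℕ j) * u (toℕ j)

  term : ∀ {q s} → (Fin q → Carrier) → ℕ → Vec (Fin q) s → Vec ℕ s → Carrier
  term x r k j = fromℕ (multinomial (2 ℕ.* r) (V.map (2 ℕ.*_) j))
                 * prodV (V.zipWith (λ kᵢ jᵢ → x kᵢ ^ jᵢ) k j)

  inner-map-suc : ∀ {q s} (x : Fin (suc q) → Carrier) m (k : Vec (Fin q) s) →
                  inner x m (V.map Fin.suc k) ≡ inner (tail x) m k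
  inner-map-suc {s = s} x m k = ≡.cong sumL (map-cong (λ j →
    ≡.cong (λ v → fromℕ (multinomial (2 ℕ.* m) (V.map (2 ℕ.*_) j)) * prodV v)
           (zipWith-map₁ (λ kᵢ jᵢ → x kᵢ ^ jᵢ) Fin.suc k j)) (comps s m))

  term-∷ : ∀ {q s} (x : Fin (suc q) → Carrier) m (k : Vec (Fin q) s) j₀ (j : Vec ℕ s) →
           j₀ ≤ m → V.sum j ≡ m ∸ j₀ →
           term x m (Fin.zero ∷ V.map Fin.suc k) (j₀ ∷ j)
             ≈ binomial₂ m j₀ * head x ^ j₀ * term (tail x) (m ∸ j₀) k j
  term-∷ x m k j₀ j j₀≤m Σj≡m∸j₀ = begin
    fromℕ (multinomial (2 ℕ.* m) (V.map (2 ℕ.*_) (j₀ ∷ j)))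
      * (head x ^ j₀ * prodV (V.zipWith (λ kᵢ jᵢ → x kᵢ ^ jᵢ) (V.map Fin.suc k) j))
      ≡⟨ ≡.cong₂ (λ n v → fromℕ n * (head x ^ j₀ * prodV v))
                 (multinomial-*2-∷ m j₀ j j₀≤m Σj≡m∸j₀)
                 (zipWith-map₁ (λ kᵢ jᵢ → x kᵢ ^ jᵢ) Fin.suc k j) ⟩
    fromℕ (B ℕ.* M) * (head x ^ j₀ * P)
      ≈⟨ *-congʳ (fromℕ-homo-* B M) ⟩
    fromℕ B * fromℕ M * (head x ^ j₀ * P)
      ≈⟨ interchange (fromℕ B) (fromℕ M) (head x ^ j₀) P ⟩
    fromℕ B * head x ^ j₀ * (fromℕ M * P) ∎
    where
    B = binomial (2 ℕ.* m) (2 ℕ.* j₀)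
    M = multinomial (2 ℕ.* (m ∸ j₀)) (V.map (2 ℕ.*_) j)
    P = prodV (V.zipWith (λ kᵢ jᵢ → tail x kᵢ ^ jᵢ) k j)

  inner-∷ : ∀ {q s} (x : Fin (suc q) → Carrier) m (k : Vec (Fin q) s) →
            inner x m (Fin.zero ∷ V.map Fin.suc k) ≈ ((head x ^_) ⋆ (λ n → inner (tail x) n k)) m
  inner-∷ {s = s} x m k = begin
    sumL (L.map f (concatMap (λ j₀ → L.map (j₀ ∷_) (comps s (m ∸ j₀))) (upTo (suc m))))
      ≈⟨ sumL-map-concatMap f (λ j₀ → L.map (j₀ ∷_) (comps s (m ∸ j₀))) (upTo (suc m)) ⟩
    sumL (L.map (λ j₀ → sumL (L.map f (L.map (j₀ ∷_) (comps s (m ∸ j₀))))) (upTo (suc m)))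
      ≡⟨ sumL-map-applyUpTo _ (λ j₀ → j₀) (suc m) ⟩
    ∑[ j < suc m ] sumL (L.map f (L.map (toℕ j ∷_) (comps s (m ∸ toℕ j))))
      ≈⟨ sum-cong-≋ {suc m} (λ j → split (toℕ j) (ℕₚ.≤-pred (toℕ<n j))) ⟩
    ((head x ^_) ⋆ (λ n → inner (tail x) n k)) m ∎
    where
    f = term x m (Fin.zero ∷ V.map Fin.suc k)
    split : ∀ j₀ → j₀ ≤ m → sumL (L.map f (L.map (j₀ ∷_) (comps s (m ∸ j₀))))
              ≈ binomial₂ m j₀ * head x ^ j₀ * inner (tail x) (m ∸ j₀) k
    split j₀ j₀≤m = begin
      sumL (L.map f (L.map (j₀ ∷_) (comps s (m ∸ j₀))))
        ≡⟨ ≡.cong sumL (map-∘ (comps s (m ∸ j₀))) ⟨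
      sumL (L.map (λ j → f (j₀ ∷ j)) (comps s (m ∸ j₀)))
        ≈⟨ sumL-map-cong (All.map (term-∷ x m k j₀ _ j₀≤m) (comps-sum≡ s (m ∸ j₀))) ⟩
      sumL (L.map (λ j → C * term (tail x) (m ∸ j₀) k j) (comps s (m ∸ j₀)))
        ≈⟨ *-distribˡ-sumL C (term (tail x) (m ∸ j₀) k) (comps s (m ∸ j₀)) ⟨
      C * inner (tail x) (m ∸ j₀) k ∎
      where C = binomial₂ m j₀ * head x ^ j₀

  subsetSum : ∀ {q} → (Fin q → Carrier) → ℕ → ℕ → Carrier
  subsetSum {q} x s m = sumL (L.map (inner x m) (incVecs q s))

  subsetSum-zero-irrelevant : ∀ {p q} (x : Fin p → Carrier) (y : Fin q → Carrier) m →
                subsetSum x 0 m ≡ subsetSum y 0 m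
  subsetSum-zero-irrelevant x y zero    = ≡.refl
  subsetSum-zero-irrelevant x y (suc m) = ≡.refl

  subsetSum-suc : ∀ {q} (x : Fin (suc q) → Carrier) s m →
    subsetSum x (suc s) m ≈ subsetSum (tail x) (suc s) m + ((head x ^_) ⋆ subsetSum (tail x) s) m
  subsetSum-suc {q} x s m = begin
    sumL (L.map (inner x m) (L.map (V.map Fin.suc) A ++ L.map (λ v → Fin.zero ∷ V.map Fin.suc v) B))
      ≈⟨ sumL-map-++ (inner x m) (L.map (V.map Fin.suc) A) _ ⟩
    sumL (L.map (inner x m) (L.map (V.map Fin.suc) A))
      + sumL (L.map (inner x m) (L.map (λ v → Fin.zero ∷ V.map Fin.suc v) B))
      ≡⟨ ≡.cong₂ (λ u v → sumL u + sumL v)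
                 (≡.trans (≡.sym (map-∘ A)) (map-cong (inner-map-suc x m) A))
                 (≡.sym (map-∘ B)) ⟩
    subsetSum (tail x) (suc s) m + sumL (L.map (λ k → inner x m (Fin.zero ∷ V.map Fin.suc k)) B)
      ≈⟨ +-congˡ (sumL-map-cong (All.universal (inner-∷ x m) B)) ⟩
    subsetSum (tail x) (suc s) m + sumL (L.map (λ k → ((head x ^_) ⋆ (λ n → inner (tail x) n k)) m) B)
      ≈⟨ +-congˡ (sumL-⋆ (head x ^_) (λ k n → inner (tail x) n k) B m) ⟩
    subsetSum (tail x) (suc s) m + ((head x ^_) ⋆ subsetSum (tail x) s) m ∎
    where
    A = incVecs q (suc s)
    B = incVecs q s

  subsetSum-empty : ∀ {q} (x : Fin q → Carrier) {s} m → q < s → subsetSum x s m ≈ 0#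
  subsetSum-empty x m q<s = reflexive (≡.cong (λ ks → sumL (L.map (inner x m) ks)) (incVecs-[] q<s))

  alternatingSum : ∀ {q} → (Fin q → Carrier) → ℕ → Carrier
  alternatingSum {q} x m = ∑[ s < suc q ] (sign (toℕ s) * subsetSum x (toℕ s) m)

  alternatingSum-tail : ∀ {q} (x : Fin (suc q) → Carrier) m →
    alternatingSum x m ≈ alternatingSum (tail x) m - ((head x ^_) ⋆ alternatingSum (tail x)) m
  alternatingSum-tail {q} x m = begin
    sign 0 * subsetSum x 0 m + ∑[ s < suc q ] (sign (suc (toℕ s)) * subsetSum x (suc (toℕ s)) m)
      ≈⟨ +-cong (*-congˡ (reflexive (subsetSum-zero-irrelevant x (tail x) m)))
                (sum-cong-≋ {suc q} (λ s → trans (*-congˡ (subsetSum-suc x (toℕ s) m))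
                                                 (distribˡ (sign (suc (toℕ s))) _ _))) ⟩
    g 0 + ∑[ s < suc q ] (g (suc (toℕ s)) + sign (suc (toℕ s)) * h (toℕ s))
      ≈⟨ +-congˡ (∑-distrib-+ {suc q} (λ s → g (suc (toℕ s)))
                                      (λ s → sign (suc (toℕ s)) * h (toℕ s))) ⟩
    g 0 + (∑[ s < suc q ] g (suc (toℕ s)) + ∑[ s < suc q ] (sign (suc (toℕ s)) * h (toℕ s)))
      ≈⟨ +-assoc _ _ _ ⟨
    ∑[ s < suc (suc q) ] g (toℕ s) + ∑[ s < suc q ] (sign (suc (toℕ s)) * h (toℕ s))
      ≈⟨ +-cong (∑-last (suc q) g) (∑-sign-suc (suc q) h) ⟩
    (alternatingSum x' m + g (suc q)) - ∑[ s < suc q ] (sign (toℕ s) * h (toℕ s))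
      ≈⟨ +-cong (trans (+-congˡ top≈0) (+-identityʳ _))
                (-‿cong (∑-⋆ (suc q) (sign ∘ toℕ) (head x ^_) (subsetSum x' ∘ toℕ) m)) ⟩
    alternatingSum x' m - ((head x ^_) ⋆ alternatingSum x') m ∎
    where
    x' = tail x
    g h : ℕ → Carrier
    g s = sign s * subsetSum x' s m
    h s = ((head x ^_) ⋆ subsetSum x' s) m
    top≈0 : g (suc q) ≈ 0#
    top≈0 = trans (*-congˡ (subsetSum-empty x' m ℕₚ.≤-refl)) (zeroʳ _)

  alternatingSum-vanishes : ∀ {q} (x : Fin q → Carrier) {m} → m < q → alternatingSum x m ≈ 0#
  alternatingSum-vanishes {suc q} x {m} (s≤s m≤q) = begin
    alternatingSum x m         ≈⟨ alternatingSum-tail x m ⟩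
    Q m - ((head x ^_) ⋆ Q) m  ≈⟨ +-congˡ (-‿cong (⋆-lowest (head x ^_) Q m Q<m≈0)) ⟩
    Q m - 1# * Q m             ≈⟨ +-congˡ (-‿cong (*-identityˡ (Q m))) ⟩
    Q m - Q m                  ≈⟨ -‿inverseʳ (Q m) ⟩
    0#                         ∎
    where
    Q = alternatingSum (tail x)
    Q<m≈0 : ∀ n → n < m → Q n ≈ 0#
    Q<m≈0 n n<m = alternatingSum-vanishes (tail x) (ℕₚ.<-≤-trans n<m m≤q)

  alternatingSum≈-LHS : ∀ q (x : Fin q → Carrier) r → alternatingSum x (suc r) ≈ - LHS q x (suc r)
  alternatingSum≈-LHS q x r = begin
    sign 0 * subsetSum x 0 (suc r) + ∑[ t < q ] (sign (suc (toℕ t)) * subsetSum x (suc (toℕ t)) (suc r))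
      ≈⟨ +-cong (trans (*-identityˡ _) (+-identityʳ 0#))
                (∑-sign-suc q (λ t → subsetSum x (suc t) (suc r))) ⟩
    0# - ∑[ t < q ] (sign (toℕ t) * subsetSum x (suc (toℕ t)) (suc r))
      ≈⟨ +-identityˡ _ ⟩
    - ∑[ t < q ] (sign (toℕ t) * subsetSum x (suc (toℕ t)) (suc r))
      ≡⟨ ≡.cong -_ (sumL-map-applyUpTo _ (λ t → t) q) ⟨
    - LHS q x (suc r) ∎

lemma1 : ∀ {c ℓ} (R : CommutativeRing c ℓ) (q : ℕ) → 1 ≤ q →
         (x : Fin q → CommutativeRing.Carrier R) (r : ℕ) → 1 ≤ r → r < q →
         CommutativeRing._≈_ R (InRing.LHS R q x r) (CommutativeRing.0# R)
lemma1 R q _ x (suc r) _ r<q = begin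
  LHS q x (suc r)                ≈⟨ -‿involutive _ ⟨
  - - LHS q x (suc r)            ≈⟨ -‿cong (alternatingSum≈-LHS R q x r) ⟨
  - alternatingSum R x (suc r)   ≈⟨ -‿cong (alternatingSum-vanishes R x r<q) ⟩
  - 0#                           ≈⟨ -0#≈0# ⟩
  0#                             ∎
  where
  open CommutativeRing R
  open InRing R using (LHS)
  open import Algebra.Properties.Ring ring using (-‿involutive; -0#≈0#)
  open import Relation.Binary.Reasoning.Setoid setoid
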